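{- Let $p$ be a prime and let $G$ be a finite group satisfying property $\mathcal P(p)$. Then $|G|\ge p^3$.
   Context: For $\ell\ge1$ and $x\in G$, $r_\ell(x)=|\{g\in G:g^\ell=x\}|$. $G$ satisfies $\mathcal P(p)$ if there exist $a,b\in G$ of the same order with $0=r_p(a)<r_p(b)$ and $r_\ell(a)=r_\ell(b)$ for every square-free integer $1<\ell<p$. -}

module Defs where

open import Data.Nat using (ℕ; zero; suc; _*_; _≤_; _<_)
open import Data.Nat.Divisibility using (_∣_)
open import Data.Fin using (Fin; _≟_)
open import Data.List using (List; length; filter; allFin)
open import Data.Product using (Σ; ∃; _×_; _,_)
open import Relation.Nullary using (¬_)
open import Relation.Binary.PropositionalEquality using (_≡_; _≢_)
open import Algebra.Structures using (IsGroup)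

SquareFree : ℕ → Set
SquareFree ℓ = ∀ d → d * d ∣ ℓ → d ≡ 1

-- A finite group of order n, presented (up to isomorphism) on the carrier Fin n
-- with propositional equality.
record FinGroup (n : ℕ) : Set where
  field
    _∙_     : Fin n → Fin n → Fin n
    ε       : Fin n
    _⁻¹     : Fin n → Fin n
    isGroup : IsGroup _≡_ _∙_ ε _⁻¹

module _ {n : ℕ} (G : FinGroup n) where
  open FinGroup G

  pow : Fin n → ℕ → Fin n
  pow g zero    = ε
  pow g (suc k) = g ∙ pow g k

  r : ℕ → Fin n → ℕ
  r ℓ x = length (filter (λ g → pow g ℓ ≟ x) (allFin n))

  HasOrder : Fin n → ℕ → Set
  HasOrder a k = 1 ≤ k × pow a k ≡ ε × (∀ j → 1 ≤ j → j < k → pow a j ≢ ε)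

  PropP : ℕ → Set
  PropP p = Σ (Fin n) λ a → Σ (Fin n) λ b →
              (∃ λ k → HasOrder a k × HasOrder b k)
            × r p a ≡ 0
            × 0 < r p b
            × (∀ ℓ → SquareFree ℓ → 1 < ℓ → ℓ < p → r ℓ a ≡ r ℓ b)

-- Suppose |G| < p³, and let a, b = c^p have the same order k, a not a p-th power. If p ∤ k, then
-- a = (a^α)^p for αp ≡ 1 (mod k); so k = mp and c has order p²m. As |G| ≥ p²m, we get m < p, and
-- ⟨c⟩ has index less than p; hence x^p ∈ ⟨c⟩ forces x ∈ ⟨c⟩, since otherwise the cosets x^j⟨c⟩,
-- j < p, would be pairwise distinct. Let d = c^m (of order p²) and W = d^p (of order p). Then a^m
-- lies in ⟨W⟩ and generates it, so a centralises W; the conjugate a d a⁻¹ is a p-th root of W, so it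
-- lies in ⟨c⟩, indeed in d⟨W⟩, and a^p commutes with d. Finally, for βp² ≡ 1 (mod m) we get
-- (a^(pβ))^p = a v with v ∈ ⟨W⟩ = ⟨d^p⟩, and writing v⁻¹ = (d^s)^p yields a = (a^(pβ) d^s)^p.
module Submission where

open import Defs
open import Level using (0ℓ)
open import Algebra.Bundles using (Group; Monoid)
open import Algebra.Structures using (IsGroup)
import Algebra.Properties.Group as GroupProperties
open import Data.Empty using (⊥-elim)
open import Data.Fin using (Fin; toℕ; remQuot)
open import Data.Fin.Properties using (_≟_; toℕ-injective; toℕ<n; injective⇒≤; *↔×)
open import Data.List using (_∷_; filter; allFin)
open import Data.List.Relation.Unary.Any using (here)
open import Data.List.Membership.Propositional using (_∈_)
open import Data.List.Membership.Propositional.Properties using (∈-length; ∈-filter⁺; ∈-filter⁻; ∈-allFin)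
open import Data.Nat
  using (ℕ; zero; suc; _+_; _*_; _≤_; _<_; _≤?_; z≤n; s≤s; NonZero; >-nonZero; >-nonZero⁻¹; ≢-nonZero;
         nonTrivial⇒n>1)
open import Data.Nat.Properties
  using (1+n≢0; *-zeroʳ; +-identityʳ; *-identityʳ; *-identityˡ; +-cancelʳ-≡; *-comm; <⇒≱; <⇒≢; ≮⇒≥;
         m*n≢0; m*n≢0⇒m≢0; m*n≢0⇒n≢0; m≤n⇒∃[o]m+o≡n; ≤-<-trans; <-≤-trans; m≤n+m; m≤n*m; ≤-total;
         m<m*n; *-cancelʳ-<; *-cancelˡ-<; *-monoʳ-≤; anyUpTo?)
open import Data.Nat.Coprimality
  using (Coprime; coprime-Bézout; prime⇒coprime) renaming (sym to Coprime-sym)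
open import Data.Nat.Divisibility
  using (_∣_; _∣?_; divides; divides-refl; ∣⇒≤; m%n≡0⇒n∣m; *-cancelˡ-∣; *-cancelʳ-∣; *-monoˡ-∣)
open import Data.Nat.DivMod using (_%_; _/_; m≡m%n+[m/n]*n; m%n<n)
open import Data.Nat.GCD using (module Bézout)
open import Data.Nat.Primality using (Prime; prime⇒irreducible; prime⇒nonZero; prime⇒nonTrivial)
open import Data.Nat.Tactic.RingSolver using (solve-∀)
open import Data.Product using (∃; ∃₂; _×_; _,_; proj₁; proj₂)
import Data.Product as Product
open import Data.Product.Properties using (×-≡,≡→≡)
open import Data.Sum using (inj₁; inj₂)
open import Function using (_∘_; Injective; Injection)
open import Function.Properties.Inverse using (Inverse⇒Injection)
open import Relation.Binary.PropositionalEquality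
open import Relation.Nullary using (¬_; Dec; yes; no)
open import Relation.Nullary.Decidable using (map′; _×-dec_)
open import Tactic.MonoidSolver using (solve)

-- A Bézout identity may come out as 1 + x e = y k, i.e. x e ≡ -1 (mod k); then x (k - 1) inverts e.
negated-inverse⇒inverse : ∀ {e k} x y .{{_ : NonZero e}} → 1 + x * e ≡ y * k →
                          ∃₂ λ α q → α * e ≡ 1 + q * k
negated-inverse⇒inverse {k = zero} x y eq = ⊥-elim (1+n≢0 (trans eq (*-zeroʳ y)))
negated-inverse⇒inverse {suc e} {suc zero} x y _ =
  1 , e , trans (+-identityʳ (suc e)) (cong suc (sym (*-identityʳ e)))
negated-inverse⇒inverse {e} {suc (suc k)} x zero ()
negated-inverse⇒inverse {e} {suc (suc k)} x (suc y) eq =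
  x * suc k , y * suc k + k , +-cancelʳ-≡ (suc k) _ _ (begin
    x * suc k * e + suc k                       ≡⟨ distribute x k e ⟩
    (1 + x * e) * suc k                         ≡⟨ cong (_* suc k) eq ⟩
    suc y * suc (suc k) * suc k                 ≡⟨ regroup y k ⟩
    1 + (y * suc k + k) * suc (suc k) + suc k   ∎)
  where
  open ≡-Reasoning
  distribute : ∀ x k e → x * suc k * e + suc k ≡ (1 + x * e) * suc k
  distribute = solve-∀
  regroup : ∀ y k → suc y * suc (suc k) * suc k ≡ 1 + (y * suc k + k) * suc (suc k) + suc k
  regroup = solve-∀

coprime⇒inverse : ∀ {e k} .{{_ : NonZero e}} → Coprime e k → ∃₂ λ α q → α * e ≡ 1 + q * k
coprime⇒inverse coprime with coprime-Bézout coprime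
... | Bézout.+- α q eq = α , q , sym eq
... | Bézout.-+ x y eq = negated-inverse⇒inverse x y eq

inverse-* : ∀ {α e q α' e' q' k} → α * e ≡ 1 + q * k → α' * e' ≡ 1 + q' * k →
            (α * α') * (e * e') ≡ 1 + (q + q' + q * q' * k) * k
inverse-* {α} {e} {q} {α'} {e'} {q'} {k} αe≡ α'e'≡ = begin
  (α * α') * (e * e')            ≡⟨ interchange α α' e e' ⟩
  (α * e) * (α' * e')            ≡⟨ cong₂ _*_ αe≡ α'e'≡ ⟩
  (1 + q * k) * (1 + q' * k)     ≡⟨ expand q q' k ⟩
  1 + (q + q' + q * q' * k) * k  ∎
  where
  open ≡-Reasoning
  interchange : ∀ α α' e e' → (α * α') * (e * e') ≡ (α * e) * (α' * e')
  interchange = solve-∀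
  expand : ∀ q q' k → (1 + q * k) * (1 + q' * k) ≡ 1 + (q + q' + q * q' * k) * k
  expand = solve-∀

prime∤⇒coprime : ∀ {p m} → Prime p → ¬ p ∣ m → Coprime p m
prime∤⇒coprime p-prime p∤m (d∣p , d∣m) with prime⇒irreducible p-prime d∣p
... | inj₁ d≡1  = d≡1
... | inj₂ refl = ⊥-elim (p∤m d∣m)

module FinGroupProperties {n : ℕ} (G : FinGroup n) where
  open FinGroup G
  open IsGroup isGroup using (assoc; identityˡ; identityʳ)

  group : Group 0ℓ 0ℓ
  group = record
    { Carrier = Fin n ; _≈_ = _≡_ ; _∙_ = _∙_ ; ε = ε ; _⁻¹ = _⁻¹ ; isGroup = isGroup }

  open GroupProperties group using (∙-cancelˡ; ∙-cancelʳ; identityʳ-unique; //-rightDividesˡ)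

  monoid : Monoid 0ℓ 0ℓ
  monoid = Group.monoid group

  infix 30 _^_
  _^_ : Fin n → ℕ → Fin n
  g ^ k = pow G g k

  ^-+ : ∀ g i j → g ^ (i + j) ≡ g ^ i ∙ g ^ j
  ^-+ g zero    j = sym (identityˡ (g ^ j))
  ^-+ g (suc i) j = trans (cong (g ∙_) (^-+ g i j)) (sym (assoc g (g ^ i) (g ^ j)))

  ^-*ʳ : ∀ g i j → g ^ (i * j) ≡ (g ^ j) ^ i
  ^-*ʳ g zero    j = refl
  ^-*ʳ g (suc i) j = trans (^-+ g j (i * j)) (cong (g ^ j ∙_) (^-*ʳ g i j))

  ^-* : ∀ g i j → g ^ (i * j) ≡ (g ^ i) ^ j
  ^-* g i j = trans (cong (g ^_) (*-comm i j)) (^-*ʳ g j i)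

  ε^ : ∀ k → ε ^ k ≡ ε
  ε^ zero    = refl
  ε^ (suc k) = trans (identityˡ (ε ^ k)) (ε^ k)

  ^-1 : ∀ g → g ^ 1 ≡ g
  ^-1 = identityʳ

  ^-comm : ∀ g i j → (g ^ i) ^ j ≡ (g ^ j) ^ i
  ^-comm g i j = trans (sym (^-* g i j)) (trans (cong (g ^_) (*-comm i j)) (^-* g j i))

  ^-periodic : ∀ {g k} → g ^ k ≡ ε → ∀ r q → g ^ (r + q * k) ≡ g ^ r
  ^-periodic {g} {k} gᵏ≡ε r q = begin
    g ^ (r + q * k)       ≡⟨ ^-+ g r (q * k) ⟩
    g ^ r ∙ g ^ (q * k)   ≡⟨ cong (g ^ r ∙_) (^-*ʳ g q k) ⟩
    g ^ r ∙ (g ^ k) ^ q   ≡⟨ cong (λ h → g ^ r ∙ h ^ q) gᵏ≡ε ⟩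
    g ^ r ∙ ε ^ q         ≡⟨ cong (g ^ r ∙_) (ε^ q) ⟩
    g ^ r ∙ ε             ≡⟨ identityʳ (g ^ r) ⟩
    g ^ r                 ∎
    where open ≡-Reasoning

  intertwine-^ : ∀ {a d x} → a ∙ d ≡ x ∙ a → ∀ k → a ∙ d ^ k ≡ x ^ k ∙ a
  intertwine-^ {a} {d} {x} ad≡xa zero    = trans (identityʳ a) (sym (identityˡ a))
  intertwine-^ {a} {d} {x} ad≡xa (suc k) = begin
    a ∙ (d ∙ d ^ k)    ≡⟨ sym (assoc a d (d ^ k)) ⟩
    (a ∙ d) ∙ d ^ k    ≡⟨ cong (_∙ d ^ k) ad≡xa ⟩
    (x ∙ a) ∙ d ^ k    ≡⟨ assoc x a (d ^ k) ⟩
    x ∙ (a ∙ d ^ k)    ≡⟨ cong (x ∙_) (intertwine-^ ad≡xa k) ⟩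
    x ∙ (x ^ k ∙ a)    ≡⟨ sym (assoc x (x ^ k) a) ⟩
    (x ∙ x ^ k) ∙ a    ∎
    where open ≡-Reasoning

  Commute : Fin n → Fin n → Set
  Commute x y = x ∙ y ≡ y ∙ x

  commute-^ʳ : ∀ {x y} j → Commute x y → Commute x (y ^ j)
  commute-^ʳ j xy≡yx = intertwine-^ xy≡yx j

  commute-^ : ∀ {x y} i j → Commute x y → Commute (x ^ i) (y ^ j)
  commute-^ i j xy≡yx = sym (commute-^ʳ i (sym (commute-^ʳ j xy≡yx)))

  ^-distrib-∙ : ∀ {x y} → Commute x y → ∀ k → (x ∙ y) ^ k ≡ x ^ k ∙ y ^ k
  ^-distrib-∙ {x} {y} xy≡yx zero    = sym (identityˡ ε)
  ^-distrib-∙ {x} {y} xy≡yx (suc k) = begin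
    (x ∙ y) ∙ (x ∙ y) ^ k        ≡⟨ cong ((x ∙ y) ∙_) (^-distrib-∙ xy≡yx k) ⟩
    (x ∙ y) ∙ (x ^ k ∙ y ^ k)    ≡⟨ solve monoid ⟩
    x ∙ ((y ∙ x ^ k) ∙ y ^ k)    ≡⟨ cong (λ h → x ∙ (h ∙ y ^ k)) (commute-^ʳ k (sym xy≡yx)) ⟩
    x ∙ ((x ^ k ∙ y) ∙ y ^ k)    ≡⟨ solve monoid ⟩
    (x ∙ x ^ k) ∙ (y ∙ y ^ k)    ∎
    where open ≡-Reasoning

  twisted-commute-^ : ∀ {a d z} → a ∙ d ≡ (d ∙ z) ∙ a → Commute a z →
                      ∀ k → a ^ k ∙ d ≡ (d ∙ z ^ k) ∙ a ^ k
  twisted-commute-^ {a} {d} {z} ad≡dza az≡za zero =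
    trans (identityˡ d) (sym (trans (identityʳ (d ∙ ε)) (identityʳ d)))
  twisted-commute-^ {a} {d} {z} ad≡dza az≡za (suc k) = begin
    (a ∙ a ^ k) ∙ d              ≡⟨ assoc a (a ^ k) d ⟩
    a ∙ (a ^ k ∙ d)              ≡⟨ cong (a ∙_) (twisted-commute-^ ad≡dza az≡za k) ⟩
    a ∙ ((d ∙ z ^ k) ∙ a ^ k)          ≡⟨ solve monoid ⟩
    ((a ∙ d) ∙ z ^ k) ∙ a ^ k          ≡⟨ cong (λ h → (h ∙ z ^ k) ∙ a ^ k) ad≡dza ⟩
    (((d ∙ z) ∙ a) ∙ z ^ k) ∙ a ^ k    ≡⟨ solve monoid ⟩
    ((d ∙ z) ∙ (a ∙ z ^ k)) ∙ a ^ k    ≡⟨ cong (λ h → ((d ∙ z) ∙ h) ∙ a ^ k) (commute-^ʳ k az≡za) ⟩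
    ((d ∙ z) ∙ (z ^ k ∙ a)) ∙ a ^ k    ≡⟨ solve monoid ⟩
    (d ∙ (z ∙ z ^ k)) ∙ (a ∙ a ^ k)    ∎
    where open ≡-Reasoning

  twisted-commute-^-ε : ∀ {a d z} k → a ∙ d ≡ (d ∙ z) ∙ a → Commute a z → z ^ k ≡ ε → Commute (a ^ k) d
  twisted-commute-^-ε {a} {d} {z} k ad≡dza az≡za zᵏ≡ε = begin
    a ^ k ∙ d              ≡⟨ twisted-commute-^ ad≡dza az≡za k ⟩
    (d ∙ z ^ k) ∙ a ^ k    ≡⟨ cong (λ h → (d ∙ h) ∙ a ^ k) zᵏ≡ε ⟩
    (d ∙ ε) ∙ a ^ k        ≡⟨ cong (_∙ a ^ k) (identityʳ d) ⟩
    d ∙ a ^ k              ∎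
    where open ≡-Reasoning

  ^-% : ∀ {g k} .{{_ : NonZero k}} → g ^ k ≡ ε → ∀ s → g ^ s ≡ g ^ (s % k)
  ^-% {g} {k} gᵏ≡ε s =
    trans (cong (g ^_) (m≡m%n+[m/n]*n s k)) (^-periodic gᵏ≡ε (s % k) (s / k))

  order-nonZero : ∀ {g k} → HasOrder G g k → NonZero k
  order-nonZero (1≤k , _) = >-nonZero 1≤k

  order-∣ : ∀ {g k} → HasOrder G g k → ∀ {s} → g ^ s ≡ ε → k ∣ s
  order-∣ {g} {k} ord@(_ , gᵏ≡ε , minimal) {s} gˢ≡ε = m%n≡0⇒n∣m s k s%k≡0
    where
    instance _ = order-nonZero ord
    s%k≡0 : s % k ≡ 0
    s%k≡0 with s % k in eq
    ... | zero  = refl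
    ... | suc r = ⊥-elim (minimal (suc r) (s≤s z≤n) (subst (_< k) eq (m%n<n s k))
                    (trans (subst (λ t → g ^ t ≡ g ^ s) eq (sym (^-% gᵏ≡ε s))) gˢ≡ε))

  ∣-minimal⇒HasOrder : ∀ {g k} → 1 ≤ k → g ^ k ≡ ε → (∀ {j} → g ^ j ≡ ε → k ∣ j) → HasOrder G g k
  ∣-minimal⇒HasOrder 1≤k gᵏ≡ε order∣ = 1≤k , gᵏ≡ε , λ j 1≤j j<k gʲ≡ε →
    <⇒≱ j<k (∣⇒≤ {{>-nonZero 1≤j}} (order∣ gʲ≡ε))

  order-^ : ∀ {g} m {q} → HasOrder G g (m * q) → HasOrder G (g ^ m) q
  order-^ {g} m {q} ord@(_ , gᵐᵠ≡ε , _) =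
    ∣-minimal⇒HasOrder (>-nonZero⁻¹ q) (trans (sym (^-* g m q)) gᵐᵠ≡ε)
      (λ {j} gᵐʲ≡ε → *-cancelˡ-∣ m (order-∣ ord (trans (^-* g m j) gᵐʲ≡ε)))
    where
    instance
      _ = m*n≢0⇒m≢0 m {{order-nonZero ord}}
      _ = m*n≢0⇒n≢0 m {{order-nonZero ord}}

  order-root : ∀ {g p k} .{{_ : NonZero p}} → HasOrder G (g ^ p) k → p ∣ k → HasOrder G g (p * k)
  order-root {g} {p} ord (divides-refl m) =
    ∣-minimal⇒HasOrder (>-nonZero⁻¹ (p * k)) (trans (^-* g p k) (proj₁ (proj₂ ord))) pk∣
    where
    k = m * p
    instance
      _ = order-nonZero ord
      _ = m*n≢0 p k
      _ = m*n≢0⇒m≢0 m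
    pk∣ : ∀ {j} → g ^ j ≡ ε → p * k ∣ j
    pk∣ {j} gʲ≡ε = from-k∣ (order-∣ ord (trans (^-comm g p j) (trans (cong (_^ p) gʲ≡ε) (ε^ p))))
      where
      from-k∣ : k ∣ j → p * k ∣ j
      from-k∣ (divides j₁ j≡j₁k) = subst (p * k ∣_) (sym j≡j₁k) (*-monoˡ-∣ k p∣j₁)
        where
        open ≡-Reasoning
        exponent : ∀ p j m → p * (j * m) ≡ j * (m * p)
        exponent = solve-∀
        k∣j₁m : k ∣ j₁ * m
        k∣j₁m = order-∣ ord (begin
          (g ^ p) ^ (j₁ * m)   ≡⟨ sym (^-* g p (j₁ * m)) ⟩
          g ^ (p * (j₁ * m))   ≡⟨ cong (g ^_) (trans (exponent p j₁ m) (sym j≡j₁k)) ⟩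
          g ^ j                ≡⟨ gʲ≡ε ⟩
          ε                    ∎)
        p∣j₁ : p ∣ j₁
        p∣j₁ = *-cancelʳ-∣ m (subst (_∣ j₁ * m) (*-comm m p) k∣j₁m)

  infix 4 _∈⟨_⟩
  _∈⟨_⟩ : Fin n → Fin n → Set
  x ∈⟨ g ⟩ = ∃ λ t → x ≡ g ^ t

  ∈⟨⟩-∙ : ∀ {g x y} → x ∈⟨ g ⟩ → y ∈⟨ g ⟩ → x ∙ y ∈⟨ g ⟩
  ∈⟨⟩-∙ {g} (s , refl) (t , refl) = s + t , sym (^-+ g s t)

  ∈⟨⟩-^ : ∀ {g x} j → x ∈⟨ g ⟩ → x ^ j ∈⟨ g ⟩
  ∈⟨⟩-^ {g} j (t , refl) = t * j , sym (^-* g t j)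

  ∈⟨⟩-trans : ∀ {g x y} → x ∈⟨ y ⟩ → y ∈⟨ g ⟩ → x ∈⟨ g ⟩
  ∈⟨⟩-trans (s , refl) y∈ = ∈⟨⟩-^ s y∈

  ∈⟨⟩-commute : ∀ {g x y} → x ∈⟨ g ⟩ → y ∈⟨ g ⟩ → Commute x y
  ∈⟨⟩-commute (s , refl) (t , refl) = commute-^ s t refl

  ∈⟨⟩-^-ε : ∀ {g x} k → x ∈⟨ g ⟩ → g ^ k ≡ ε → x ^ k ≡ ε
  ∈⟨⟩-^-ε {g} k (t , refl) gᵏ≡ε = trans (^-comm g t k) (trans (cong (_^ t) gᵏ≡ε) (ε^ t))

  ∈⟨⟩-inverse : ∀ {g k x} → HasOrder G g k → x ∈⟨ g ⟩ → ∃ λ y → y ∈⟨ g ⟩ × x ∙ y ≡ ε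
  ∈⟨⟩-inverse {k = suc k} (_ , gᵏ≡ε , _) x∈ = _ , ∈⟨⟩-^ k x∈ , ∈⟨⟩-^-ε (suc k) x∈ gᵏ≡ε

  ∈⟨⟩-cancelʳ : ∀ {g k x h} → HasOrder G g k → h ∈⟨ g ⟩ → x ∙ h ∈⟨ g ⟩ → x ∈⟨ g ⟩
  ∈⟨⟩-cancelʳ {x = x} {h} ord h∈ xh∈ with ∈⟨⟩-inverse ord h∈
  ... | h' , h'∈ , hh'≡ε = subst (_∈⟨ _ ⟩) x≡ (∈⟨⟩-∙ xh∈ h'∈)
    where
    x≡ : (x ∙ h) ∙ h' ≡ x
    x≡ = trans (assoc x h h') (trans (cong (x ∙_) hh'≡ε) (identityʳ x))

  ^-injective-≤ : ∀ {g k i j} → HasOrder G g k → i ≤ j → j < k → g ^ i ≡ g ^ j → i ≡ j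
  ^-injective-≤ {g} {i = i} (_ , _ , minimal) i≤j j<k gⁱ≡gʲ with m≤n⇒∃[o]m+o≡n i≤j
  ... | zero  , refl = sym (+-identityʳ i)
  ... | suc δ , refl = ⊥-elim (minimal (suc δ) (s≤s z≤n) (≤-<-trans (m≤n+m (suc δ) i) j<k)
                          (identityʳ-unique (g ^ i) _ (sym (trans gⁱ≡gʲ (^-+ g i (suc δ))))))

  ^-injective : ∀ {g k i j} → HasOrder G g k → i < k → j < k → g ^ i ≡ g ^ j → i ≡ j
  ^-injective {i = i} {j} ord i<k j<k gⁱ≡gʲ with ≤-total i j
  ... | inj₁ i≤j = ^-injective-≤ ord i≤j j<k gⁱ≡gʲ
  ... | inj₂ j≤i = sym (^-injective-≤ ord j≤i i<k (sym gⁱ≡gʲ))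

  coprime⇒∈⟨^⟩ : ∀ {g e k} .{{_ : NonZero e}} → Coprime e k → g ^ k ≡ ε → g ∈⟨ g ^ e ⟩
  coprime⇒∈⟨^⟩ {g} {e} {k} coprime gᵏ≡ε with coprime⇒inverse coprime
  ... | α , q , αe≡1+qk = α , (begin
    g                  ≡⟨ sym (^-1 g) ⟩
    g ^ 1              ≡⟨ sym (^-periodic gᵏ≡ε 1 q) ⟩
    g ^ (1 + q * k)    ≡⟨ cong (g ^_) (sym αe≡1+qk) ⟩
    g ^ (α * e)        ≡⟨ ^-*ʳ g α e ⟩
    (g ^ e) ^ α        ∎)
    where open ≡-Reasoning

  ∈⟨^⟩⇒pth-power : ∀ {g p x} → x ∈⟨ g ^ p ⟩ → ∃ λ s → (g ^ s) ^ p ≡ x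
  ∈⟨^⟩⇒pth-power {g} {p} (s , refl) = s , ^-comm g s p

  coprime-order⇒pth-power : ∀ {g p k} .{{_ : NonZero p}} → Coprime p k → g ^ k ≡ ε →
                            ∃ λ h → h ^ p ≡ g
  coprime-order⇒pth-power {g} {p} coprime gᵏ≡ε =
    let s , gˢᵖ≡g = ∈⟨^⟩⇒pth-power {g} {p} (coprime⇒∈⟨^⟩ coprime gᵏ≡ε) in g ^ s , gˢᵖ≡g

  torsion-∈⟨^⟩ : ∀ {g x} r q → HasOrder G g (r * q) → x ∈⟨ g ⟩ → x ^ q ≡ ε → x ∈⟨ g ^ r ⟩
  torsion-∈⟨^⟩ {g} r q ord (t , refl) xᵠ≡ε = in⟨gʳ⟩ (*-cancelʳ-∣ q (order-∣ ord (trans (^-* g t q) xᵠ≡ε)))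
    where
    instance _ = m*n≢0⇒n≢0 r {{order-nonZero ord}}
    in⟨gʳ⟩ : r ∣ t → g ^ t ∈⟨ g ^ r ⟩
    in⟨gʳ⟩ (divides s t≡sr) = s , trans (cong (g ^_) t≡sr) (^-*ʳ g s r)

  prime-order⇒generated : ∀ {g p x} → Prime p → HasOrder G g p → x ∈⟨ g ⟩ → x ≢ ε → g ∈⟨ x ⟩
  prime-order⇒generated {g} {p} p-prime ord@(_ , gᵖ≡ε , _) (t , refl) gᵗ≢ε =
    coprime⇒∈⟨^⟩ {{t≢0}} (Coprime-sym (prime∤⇒coprime p-prime p∤t)) gᵖ≡ε
    where
    p∤t : ¬ p ∣ t
    p∤t (divides-refl s) = gᵗ≢ε (trans (^-*ʳ g s p) (trans (cong (_^ s) gᵖ≡ε) (ε^ s)))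
    t≢0 : NonZero t
    t≢0 = ≢-nonZero λ { refl → gᵗ≢ε refl }

  module CyclicSubgroup {c L} (ord-c : HasOrder G c L) where
    private instance _ = order-nonZero ord-c

    ∈⟨⟩? : ∀ x → Dec (x ∈⟨ c ⟩)
    ∈⟨⟩? x = map′ (λ (t , _ , x≡cᵗ) → t , x≡cᵗ)
                  (λ (t , x≡cᵗ) → t % L , m%n<n t L , trans x≡cᵗ (^-% (proj₁ (proj₂ ord-c)) t))
                  (anyUpTo? (λ t → x ≟ c ^ t) L)

    module Cosets {x i} (avoids : ∀ j → 1 ≤ j → j < i → ¬ x ^ j ∈⟨ c ⟩) where
      shifted-coset : ∀ {δ t t'} → δ < i → t < L → t' < L → c ^ t ≡ x ^ δ ∙ c ^ t' → δ ≡ 0 × t ≡ t'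
      shifted-coset {zero} _ t<L t'<L cᵗ≡cᵗ' =
        refl , ^-injective ord-c t<L t'<L (trans cᵗ≡cᵗ' (identityˡ _))
      shifted-coset {suc δ} {t} {t'} δ<i _ _ cᵗ≡xᵟcᵗ' =
        ⊥-elim (avoids (suc δ) (s≤s z≤n) δ<i (∈⟨⟩-cancelʳ ord-c (t' , refl) (t , sym cᵗ≡xᵟcᵗ')))

      coset-injective-≤ : ∀ {j j' t t'} → j ≤ j' → j' < i → t < L → t' < L →
                          x ^ j ∙ c ^ t ≡ x ^ j' ∙ c ^ t' → j ≡ j' × t ≡ t'
      coset-injective-≤ {j} {t = t} {t'} j≤j' j'<i t<L t'<L eq with m≤n⇒∃[o]m+o≡n j≤j'
      ... | δ , refl = Product.map₁ (λ δ≡0 → sym (trans (cong (j +_) δ≡0) (+-identityʳ j)))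
        (shifted-coset (≤-<-trans (m≤n+m δ j) j'<i) t<L t'<L (∙-cancelˡ (x ^ j) _ _ (begin
          x ^ j ∙ c ^ t              ≡⟨ eq ⟩
          x ^ (j + δ) ∙ c ^ t'       ≡⟨ cong (_∙ c ^ t') (^-+ x j δ) ⟩
          (x ^ j ∙ x ^ δ) ∙ c ^ t'   ≡⟨ assoc (x ^ j) (x ^ δ) (c ^ t') ⟩
          x ^ j ∙ (x ^ δ ∙ c ^ t')   ∎)))
        where open ≡-Reasoning

      coset-map : Fin i × Fin L → Fin n
      coset-map (j , t) = x ^ toℕ j ∙ c ^ toℕ t

      coset-map-injective : Injective _≡_ _≡_ coset-map
      coset-map-injective {j , t} {j' , t'} eq = ×-≡,≡→≡ (Product.map toℕ-injective toℕ-injective toℕ-pair≡)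
        where
        toℕ-pair≡ : toℕ j ≡ toℕ j' × toℕ t ≡ toℕ t'
        toℕ-pair≡ with ≤-total (toℕ j) (toℕ j')
        ... | inj₁ j≤j' = coset-injective-≤ j≤j' (toℕ<n j') (toℕ<n t) (toℕ<n t') eq
        ... | inj₂ j'≤j =
          Product.map sym sym (coset-injective-≤ j'≤j (toℕ<n j) (toℕ<n t') (toℕ<n t) (sym eq))

      cosets-≤ : i * L ≤ n
      cosets-≤ = injective⇒≤ {f = coset-map ∘ remQuot L}
        (Injection.injective (Inverse⇒Injection *↔×) ∘ coset-map-injective)

    ∈⟨⟩-coprime-powers : ∀ {x j k} .{{_ : NonZero j}} → Coprime j k →
                         x ^ j ∈⟨ c ⟩ → x ^ k ∈⟨ c ⟩ → x ∈⟨ c ⟩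
    ∈⟨⟩-coprime-powers {x} {j} {k} coprime xʲ∈ xᵏ∈ with coprime⇒inverse coprime
    ... | α , q , αj≡1+qk = ∈⟨⟩-cancelʳ ord-c (∈⟨⟩-^ q xᵏ∈) (subst (_∈⟨ c ⟩) x^αj≡ (∈⟨⟩-^ α xʲ∈))
      where
      x^αj≡ : (x ^ j) ^ α ≡ x ∙ (x ^ k) ^ q
      x^αj≡ = trans (sym (^-*ʳ x α j)) (trans (cong (x ^_) αj≡1+qk) (cong (x ∙_) (^-*ʳ x q k)))

    pth-root-closed : ∀ {p} → Prime p → n < p * L → ∀ {x} → x ^ p ∈⟨ c ⟩ → x ∈⟨ c ⟩
    pth-root-closed {p} p-prime index {x} xᵖ∈ with anyUpTo? (λ j → (1 ≤? j) ×-dec ∈⟨⟩? (x ^ j)) p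
    ... | yes (j , j<p , 1≤j , xʲ∈) =
      ∈⟨⟩-coprime-powers {{j≢0}} (Coprime-sym (prime⇒coprime p-prime {{j≢0}} j<p)) xʲ∈ xᵖ∈
      where j≢0 = >-nonZero 1≤j
    ... | no none = ⊥-elim (<⇒≱ index (Cosets.cosets-≤ λ j 1≤j j<p xʲ∈ → none (j , j<p , 1≤j , xʲ∈)))

    subgroup-≤ : L ≤ n
    subgroup-≤ = subst (_≤ n) (*-identityˡ L)
      (Cosets.cosets-≤ {x = ε} {i = 1} λ j 1≤j j<1 _ → <⇒≱ j<1 1≤j)

  module PthRoot {p a c m} (p-prime : Prime p) (coprime : Coprime p m)
                 (ord-a : HasOrder G a (m * p)) (ord-c : HasOrder G c (p * (m * p)))
                 (index : n < p * (p * (m * p))) where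
    private instance
      _ = prime⇒nonZero p-prime
      _ = m*n≢0⇒m≢0 m {{order-nonZero ord-a}}

    open CyclicSubgroup ord-c using (pth-root-closed)

    d W : Fin n
    d = c ^ m
    W = d ^ p

    c^mp≡W : c ^ (m * p) ≡ W
    c^mp≡W = ^-* c m p

    ord-c-over-W : HasOrder G c (m * p * p)
    ord-c-over-W = subst (HasOrder G c) (*-comm p (m * p)) ord-c

    ord-c-over-d : HasOrder G c (m * (p * p))
    ord-c-over-d = subst (HasOrder G c) (exponent p m) ord-c
      where
      exponent : ∀ p m → p * (m * p) ≡ m * (p * p)
      exponent = solve-∀

    ord-d : HasOrder G d (p * p)
    ord-d = order-^ m ord-c-over-d

    ord-W : HasOrder G W p
    ord-W = order-^ p ord-d

    Wᵖ≡ε : W ^ p ≡ ε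
    Wᵖ≡ε = proj₁ (proj₂ ord-W)

    1<p : 1 < p
    1<p = nonTrivial⇒n>1 p {{prime⇒nonTrivial p-prime}}

    W≢ε : W ≢ ε
    W≢ε = proj₂ (proj₂ ord-d) p (>-nonZero⁻¹ p) (m<m*n p p 1<p)

    a∈⟨a⟩ : a ∈⟨ a ⟩
    a∈⟨a⟩ = 1 , sym (^-1 a)

    aᵐ∈⟨W⟩ : a ^ m ∈⟨ W ⟩
    aᵐ∈⟨W⟩ = subst (a ^ m ∈⟨_⟩) c^mp≡W
      (torsion-∈⟨^⟩ (m * p) p ord-c-over-W (pth-root-closed p-prime index (0 , aᵐᵖ≡ε)) aᵐᵖ≡ε)
      where
      aᵐᵖ≡ε : (a ^ m) ^ p ≡ ε
      aᵐᵖ≡ε = trans (sym (^-* a m p)) (proj₁ (proj₂ ord-a))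

    W∈⟨a⟩ : W ∈⟨ a ⟩
    W∈⟨a⟩ = ∈⟨⟩-trans (prime-order⇒generated p-prime ord-W aᵐ∈⟨W⟩ aᵐ≢ε) (m , refl)
      where
      aᵐ≢ε : a ^ m ≢ ε
      aᵐ≢ε = proj₂ (proj₂ ord-a) m (>-nonZero⁻¹ m) (m<m*n m p 1<p)

    dᵃ : Fin n
    dᵃ = (a ∙ d) ∙ (a ⁻¹)

    ad≡dᵃa : a ∙ d ≡ dᵃ ∙ a
    ad≡dᵃa = sym (//-rightDividesˡ a (a ∙ d))

    dᵃ^p≡W : dᵃ ^ p ≡ W
    dᵃ^p≡W = ∙-cancelʳ a (dᵃ ^ p) W (trans (sym (intertwine-^ ad≡dᵃa p)) (∈⟨⟩-commute a∈⟨a⟩ W∈⟨a⟩))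

    dᵃ∈⟨d⟩ : dᵃ ∈⟨ d ⟩
    dᵃ∈⟨d⟩ = torsion-∈⟨^⟩ m (p * p) ord-c-over-d
      (pth-root-closed p-prime index (m * p , trans dᵃ^p≡W (sym c^mp≡W)))
      (trans (^-* dᵃ p p) (trans (cong (_^ p) dᵃ^p≡W) Wᵖ≡ε))

    dᵃ≡dz : ∃ λ z → z ∈⟨ W ⟩ × dᵃ ≡ d ∙ z
    dᵃ≡dz = split dᵃ∈⟨d⟩
      where
      split : dᵃ ∈⟨ d ⟩ → ∃ λ z → z ∈⟨ W ⟩ × dᵃ ≡ d ∙ z
      split (zero  , dᵃ≡ε)     = ⊥-elim (W≢ε (trans (sym dᵃ^p≡W) (trans (cong (_^ p) dᵃ≡ε) (ε^ p))))
      split (suc r , dᵃ≡d¹⁺ʳ) = d ^ r , torsion-∈⟨^⟩ p p ord-d (r , refl) zᵖ≡ε , dᵃ≡d¹⁺ʳ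
        where
        zᵖ≡ε : (d ^ r) ^ p ≡ ε
        zᵖ≡ε = identityʳ-unique W ((d ^ r) ^ p) (begin
          W ∙ (d ^ r) ^ p    ≡⟨ sym (^-distrib-∙ (commute-^ʳ r refl) p) ⟩
          (d ∙ d ^ r) ^ p    ≡⟨ cong (_^ p) (sym dᵃ≡d¹⁺ʳ) ⟩
          dᵃ ^ p             ≡⟨ dᵃ^p≡W ⟩
          W                  ∎)
          where open ≡-Reasoning

    aᵖ-commutes-d : Commute (a ^ p) d
    aᵖ-commutes-d = let z , z∈⟨W⟩ , dᵃ≡dz = dᵃ≡dz in
      twisted-commute-^-ε p (trans ad≡dᵃa (cong (_∙ a) dᵃ≡dz))
        (∈⟨⟩-commute a∈⟨a⟩ (∈⟨⟩-trans z∈⟨W⟩ W∈⟨a⟩)) (∈⟨⟩-^-ε p z∈⟨W⟩ Wᵖ≡ε)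

    aᵖ-root-modulo-W : ∃₂ λ β v → v ∈⟨ W ⟩ × ((a ^ p) ^ β) ^ p ≡ a ∙ v
    aᵖ-root-modulo-W = from-inverse (coprime⇒inverse coprime)
      where
      from-inverse : (∃₂ λ α q → α * p ≡ 1 + q * m) → ∃₂ λ β v → v ∈⟨ W ⟩ × ((a ^ p) ^ β) ^ p ≡ a ∙ v
      from-inverse (α , q , αp≡1+qm) = β , (a ^ m) ^ Q , ∈⟨⟩-^ Q aᵐ∈⟨W⟩ , (begin
        ((a ^ p) ^ β) ^ p    ≡⟨ sym (trans (^-* a (p * β) p) (cong (_^ p) (^-* a p β))) ⟩
        a ^ (p * β * p)      ≡⟨ cong (a ^_) (trans (exponent p β) βpp≡1+Qm) ⟩
        a ^ (1 + Q * m)      ≡⟨ cong (a ∙_) (^-*ʳ a Q m) ⟩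
        a ∙ (a ^ m) ^ Q      ∎)
        where
        open ≡-Reasoning
        β = α * α
        Q = q + q + q * q * m
        βpp≡1+Qm : β * (p * p) ≡ 1 + Q * m
        βpp≡1+Qm = inverse-* {α} {p} {q} {α} {p} {q} {m} αp≡1+qm αp≡1+qm
        exponent : ∀ p β → p * β * p ≡ β * (p * p)
        exponent = solve-∀

    pth-power : ∃ λ h → h ^ p ≡ a
    pth-power =
      let β , v , v∈⟨W⟩ , aᵖᵝᵖ≡av = aᵖ-root-modulo-W
          v' , v'∈⟨W⟩ , vv'≡ε      = ∈⟨⟩-inverse ord-W v∈⟨W⟩
          s , dˢᵖ≡v'               = ∈⟨^⟩⇒pth-power {d} {p} v'∈⟨W⟩
      in (a ^ p) ^ β ∙ d ^ s , (begin
        ((a ^ p) ^ β ∙ d ^ s) ^ p          ≡⟨ ^-distrib-∙ (commute-^ β s aᵖ-commutes-d) p ⟩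
        ((a ^ p) ^ β) ^ p ∙ (d ^ s) ^ p    ≡⟨ cong₂ _∙_ aᵖᵝᵖ≡av dˢᵖ≡v' ⟩
        (a ∙ v) ∙ v'                       ≡⟨ assoc a v v' ⟩
        a ∙ (v ∙ v')                       ≡⟨ cong (a ∙_) vv'≡ε ⟩
        a ∙ ε                              ≡⟨ identityʳ a ⟩
        a                                  ∎)
      where open ≡-Reasoning

  r≡0⇒no-root : ∀ {ℓ x} → r G ℓ x ≡ 0 → ∀ h → h ^ ℓ ≢ x
  r≡0⇒no-root {ℓ} {x} r≡0 h hˡ≡x =
    <⇒≢ (∈-length (∈-filter⁺ (λ g → g ^ ℓ ≟ x) (∈-allFin h) hˡ≡x)) (sym r≡0)

  r>0⇒root : ∀ {ℓ x} → 0 < r G ℓ x → ∃ λ h → h ^ ℓ ≡ x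
  r>0⇒root {ℓ} {x} r>0 with filter (λ g → g ^ ℓ ≟ x) (allFin n) in eq
  ... | h ∷ _ = h , proj₂ (∈-filter⁻ (λ g → g ^ ℓ ≟ x) {xs = allFin n} (subst (h ∈_) (sym eq) (here refl)))

  same-order-as-pth-power⇒pth-power : ∀ {p a c k} → Prime p → n < p * (p * p) →
    HasOrder G a k → HasOrder G (c ^ p) k → ∃ λ h → h ^ p ≡ a
  same-order-as-pth-power⇒pth-power {p} {a} {c} {k} p-prime small ord-a ord-cᵖ with p ∣? k
  ... | no p∤k = coprime-order⇒pth-power (prime∤⇒coprime p-prime p∤k) (proj₁ (proj₂ ord-a))
    where instance _ = prime⇒nonZero p-prime
  ... | yes (divides-refl m) = PthRoot.pth-power p-prime coprime ord-a ord-c index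
    where
    instance
      _ = prime⇒nonZero p-prime
      _ = m*n≢0⇒m≢0 m {{order-nonZero ord-a}}
    ord-c : HasOrder G c (p * (m * p))
    ord-c = order-root ord-cᵖ (divides-refl m)
    m<p : m < p
    m<p = *-cancelʳ-< p m p (*-cancelˡ-< p (m * p) (p * p)
            (≤-<-trans (CyclicSubgroup.subgroup-≤ ord-c) small))
    coprime : Coprime p m
    coprime = prime⇒coprime p-prime m<p
    index : n < p * (p * (m * p))
    index = <-≤-trans small (*-monoʳ-≤ p (*-monoʳ-≤ p (m≤n*m p m)))

open import Data.Nat using (_^_)

proposition3p3 : (p : ℕ) → Prime p → (n : ℕ) → (G : FinGroup n) → PropP G p → p ^ 3 ≤ n
proposition3p3 p p-prime n G (a , b , (k , ord-a , ord-b) , r≡0 , r>0 , _) = ≮⇒≥ λ n<p³ →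
  let c , cᵖ≡b = r>0⇒root {p} r>0
      h , hᵖ≡a = same-order-as-pth-power⇒pth-power {c = c} p-prime (subst (n <_) p³≡ n<p³) ord-a
                   (subst (λ b → HasOrder G b k) (sym cᵖ≡b) ord-b)
  in r≡0⇒no-root {p} r≡0 h hᵖ≡a
  where
  open FinGroupProperties G using (r≡0⇒no-root; r>0⇒root; same-order-as-pth-power⇒pth-power)
  p³≡ : p ^ 3 ≡ p * (p * p)
  p³≡ = cong (λ x → p * (p * x)) (*-identityʳ p)
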